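{- For any positive integers $n$ and $k$ with $n \ge 2k$, $$JL_{n,k-1} = \frac{kn}{(n+1)(n-2k+2)} JL_{n+1,k} + \frac{2k}{n-2k+2} JL_{n,k},$$ $$JL_{n,k+1} = -\frac{n(n-2k+1)}{5(n+1)(k+1)} JL_{n+1,k} + \frac{3n-5k}{5(k+1)} JL_{n,k},$$ $$JL_{n+2,k} = \frac{(n-k+1)(n+2)}{(n+1)(n-2k+2)} JL_{n+1,k} + \frac{n+2}{n-2k+2} JL_{n,k}.$$
   Context: For integers $n \ge 1$ and $k \ge 0$, $JL_{n,k} = \sum_{i=k}^{\lfloor n/2 \rfloor} \frac{n}{n-i} \binom{n-i}{i} \binom{i}{k}$, where an empty sum (when $k > \lfloor n/2 \rfloor$) equals $0$. -}

module Defs where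

open import Data.Nat using (ℕ; zero; suc; _+_; _*_; _∸_; _/_)
open import Data.Nat.Combinatorics using (_C_)
open import Data.Integer using (ℤ; +_)
open import Data.Rational using (ℚ; 0ℚ) renaming (_+_ to _+ℚ_; _*_ to _*ℚ_; _/_ to _/ℚ_)
open import Data.List using (List; map; upTo; foldr)

-- a / b as a rational number; convention a / 0 = 0 (only ever used with b ≠ 0)
frac : ℤ → ℕ → ℚ
frac a zero    = 0ℚ
frac a (suc b) = a /ℚ suc b

sumℚ : List ℚ → ℚ
sumℚ = foldr _+ℚ_ 0ℚ

-- the indices i = k, k+1, ..., ⌊n/2⌋ (empty list if k > ⌊n/2⌋)
range : ℕ → ℕ → List ℕ
range k m = map (λ j → k + j) (upTo (suc m ∸ k))

JL : ℕ → ℕ → ℚ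
JL n k = sumℚ (map (λ i → frac (+ n) (n ∸ i) *ℚ frac (+ (((n ∸ i) C i) * (i C k))) 1)
                   (range k (n / 2)))

-- Put y = 1 + x.  The polynomials f_m(y) = Σᵢ C(m-i,i) yⁱ and L_n(y) = Σᵢ n/(n-i) C(n-i,i) yⁱ
-- satisfy f_{m+2} = f_{m+1} + y f_m, L_{p+2} = f_{p+2} + y f_p and dL_{p+2}/dy = (p+2) f_p, the
-- last two by absorption, (i+1) C(a+1,i+1) = (a+1) C(a,i).  JL n k is the coefficient of xᵏ in
-- L_n(1 + x).  In terms of the x-coefficients u, v of f_{n-1}, f_{n-2} (multiplication by y acts
-- on coefficients as c ↦ c + shift c) this gives JL_n = u + 2yv, JL_{n+1} = f_n + 2yu,
-- JL_{n+2} = JL_{n+1} + y JL_n and k JL_{n,k} = n v_{k-1}.  With denominators cleared, each of the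
-- three identities is a linear consequence of these relations among natural numbers, and is then
-- transported to ℚ.

module Submission where

open import Defs
open import Data.Nat using (ℕ; suc; _+_; _*_; _∸_; _≤_)
open import Data.Integer using (+_) renaming (_-_ to _-ℤ_)
open import Data.Rational using (ℚ) renaming (_+_ to _+ℚ_; _*_ to _*ℚ_; -_ to -ℚ_)
open import Relation.Binary.PropositionalEquality using (_≡_)
open import Data.Product using (_×_)

open import Function using (_∘_)
open import Data.Nat using (zero; pred; _<_; _/_; NonZero; >-nonZero; _≤?_; _<?_; z≤n; s≤s; s≤s⁻¹; z<s; s<s)
open import Data.Nat.Properties
open import Data.Nat.DivMod using (m/n≤m; m*n/n≡m; /-monoˡ-≤)
open import Data.Nat.Combinatorics using (_C_; nCk+nC[k+1]≡[n+1]C[k+1]; k>n⇒nCk≡0; nC1≡n)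
open import Data.Nat.Tactic.RingSolver using (solve-∀; solve)
open import Data.Integer as ℤ using (ℤ; _⊖_)
import Data.Integer.Properties as ℤ
open import Data.Integer.Tactic.RingSolver using () renaming (solve-∀ to ℤ-solve-∀)
open import Data.Rational using (0ℚ; toℚᵘ)
import Data.Rational.Properties as ℚ
open import Data.Rational.Properties using (toℚᵘ-injective; toℚᵘ-fromℚᵘ; toℚᵘ-homo-+; toℚᵘ-homo-*; toℚᵘ-homo‿-)
open import Data.Rational.Unnormalised as ℚᵘ using (mkℚᵘ; *≡*; _≃_)
import Data.Rational.Unnormalised.Properties as ℚᵘ
open import Data.List using (_∷_; []; map; upTo; applyUpTo)
open import Data.List.Properties using (map-upTo; map-applyUpTo)
open import Data.Product using (_,_)
open import Relation.Binary.PropositionalEquality using (refl; sym; trans; cong; cong₂; subst; module ≡-Reasoning)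
open import Relation.Nullary using (yes; no; contradiction)

∑ : ℕ → (ℕ → ℕ) → ℕ
∑ zero    f = 0
∑ (suc N) f = f 0 + ∑ N (f ∘ suc)

syntax ∑ N (λ i → e) = ∑[ i < N ] e

∑-cong : ∀ N {f g : ℕ → ℕ} → (∀ i → i < N → f i ≡ g i) → ∑ N f ≡ ∑ N g
∑-cong zero    f≗g = refl
∑-cong (suc N) f≗g = cong₂ _+_ (f≗g 0 z<s) (∑-cong N (λ i i<N → f≗g (suc i) (s<s i<N)))

∑-distrib-+ : ∀ N (f g : ℕ → ℕ) → ∑[ i < N ] (f i + g i) ≡ ∑ N f + ∑ N g
∑-distrib-+ zero    f g = refl
∑-distrib-+ (suc N) f g = begin
  f 0 + g 0 + ∑[ i < N ] (f (suc i) + g (suc i))   ≡⟨ cong (_+_ (f 0 + g 0)) (∑-distrib-+ N (f ∘ suc) (g ∘ suc)) ⟩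
  f 0 + g 0 + (∑ N (f ∘ suc) + ∑ N (g ∘ suc))     ≡⟨ +-exchange (f 0) (g 0) _ _ ⟩
  f 0 + ∑ N (f ∘ suc) + (g 0 + ∑ N (g ∘ suc))     ∎
  where
  open ≡-Reasoning
  +-exchange : ∀ a b c d → a + b + (c + d) ≡ a + c + (b + d)
  +-exchange = solve-∀

*-distribˡ-∑ : ∀ N c (f : ℕ → ℕ) → c * ∑ N f ≡ ∑[ i < N ] (c * f i)
*-distribˡ-∑ zero    c f = *-zeroʳ c
*-distribˡ-∑ (suc N) c f = trans (*-distribˡ-+ c (f 0) _) (cong (_+_ (c * f 0)) (*-distribˡ-∑ N c (f ∘ suc)))

∑-zeros : ∀ N (f : ℕ → ℕ) → (∀ i → f i ≡ 0) → ∑ N f ≡ 0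
∑-zeros zero    f f≡0 = refl
∑-zeros (suc N) f f≡0 = cong₂ _+_ (f≡0 0) (∑-zeros N (f ∘ suc) (f≡0 ∘ suc))

∑-trailing-zeros : ∀ {N M} (f : ℕ → ℕ) → N ≤ M → (∀ i → N ≤ i → f i ≡ 0) → ∑ M f ≡ ∑ N f
∑-trailing-zeros {zero}  {M}     f _         f≡0 = ∑-zeros M f (λ i → f≡0 i z≤n)
∑-trailing-zeros {suc N} {suc M} f (s≤s N≤M) f≡0 =
  cong (_+_ (f 0)) (∑-trailing-zeros (f ∘ suc) N≤M (λ i N≤i → f≡0 (suc i) (s≤s N≤i)))

∑-leading-zeros : ∀ N k (f : ℕ → ℕ) → (∀ i → i < k → f i ≡ 0) → ∑ N f ≡ ∑[ i < N ∸ k ] f (k + i)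
∑-leading-zeros N       zero    f f≡0 = refl
∑-leading-zeros zero    (suc k) f f≡0 = refl
∑-leading-zeros (suc N) (suc k) f f≡0 =
  cong₂ _+_ (f≡0 0 z<s) (∑-leading-zeros N k (f ∘ suc) (λ i i<k → f≡0 (suc i) (s<s i<k)))

[k+1]*[n+1]C[k+1]≡[n+1]*nCk : ∀ n k → suc k * (suc n C suc k) ≡ suc n * (n C k)
[k+1]*[n+1]C[k+1]≡[n+1]*nCk zero    zero    = refl
[k+1]*[n+1]C[k+1]≡[n+1]*nCk zero    (suc k) = *-zeroʳ (2 + k)
[k+1]*[n+1]C[k+1]≡[n+1]*nCk (suc n) zero    = trans (+-identityʳ _) (trans (nC1≡n (2 + n)) (sym (*-identityʳ (2 + n))))
[k+1]*[n+1]C[k+1]≡[n+1]*nCk (suc n) (suc k) = begin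
  (2 + k) * (suc (suc n) C suc (suc k))
    ≡⟨ cong ((2 + k) *_) (nCk+nC[k+1]≡[n+1]C[k+1] (suc n) (suc k)) ⟨
  (2 + k) * (suc n C suc k + suc n C suc (suc k))
    ≡⟨ split (suc n C suc k) (suc n C suc (suc k)) k ⟩
  suc n C suc k + suc k * (suc n C suc k) + suc (suc k) * (suc n C suc (suc k))
    ≡⟨ cong₂ (λ x y → suc n C suc k + x + y) ([k+1]*[n+1]C[k+1]≡[n+1]*nCk n k) ([k+1]*[n+1]C[k+1]≡[n+1]*nCk n (suc k)) ⟩
  suc n C suc k + suc n * (n C k) + suc n * (n C suc k)
    ≡⟨ join (suc n C suc k) (n C k) (n C suc k) n ⟩
  suc n C suc k + suc n * (n C k + n C suc k)
    ≡⟨ cong (λ x → suc n C suc k + suc n * x) (nCk+nC[k+1]≡[n+1]C[k+1] n k) ⟩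
  (2 + n) * (suc n C suc k)
    ∎
  where
  open ≡-Reasoning
  split : ∀ x y k → (2 + k) * (x + y) ≡ x + (1 + k) * x + (2 + k) * y
  split = solve-∀
  join : ∀ x y z n → x + (1 + n) * y + (1 + n) * z ≡ x + (1 + n) * (y + z)
  join = solve-∀

-- Taylor shift

shift : (ℕ → ℕ) → ℕ → ℕ
shift a zero    = 0
shift a (suc k) = a k

shift-cong : ∀ {f g : ℕ → ℕ} → (∀ k → f k ≡ g k) → ∀ k → shift f k ≡ shift g k
shift-cong f≗g zero    = refl
shift-cong f≗g (suc k) = f≗g k

-- The coefficient of xᵏ in Σ_{i<N} a i · (1 + x)ⁱ.
taylorShift : ℕ → (ℕ → ℕ) → ℕ → ℕ
taylorShift N a k = ∑[ i < N ] (a i * (i C k))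

taylorShift-+ : ∀ N (a b : ℕ → ℕ) k →
  taylorShift N (λ i → a i + b i) k ≡ taylorShift N a k + taylorShift N b k
taylorShift-+ N a b k = trans (∑-cong N (λ i _ → *-distribʳ-+ (i C k) (a i) (b i))) (∑-distrib-+ N _ _)

taylorShift-* : ∀ N c a k → taylorShift N (λ i → c * a i) k ≡ c * taylorShift N a k
taylorShift-* N c a k = trans (∑-cong N (λ i _ → *-assoc c (a i) (i C k))) (sym (*-distribˡ-∑ N c _))

taylorShift-shift : ∀ N a k → taylorShift (suc N) (shift a) k ≡ taylorShift N a k + shift (taylorShift N a) k
taylorShift-shift N a zero    = sym (+-identityʳ _)
taylorShift-shift N a (suc k) = trans (∑-cong N (λ i _ → pascal i)) (∑-distrib-+ N _ _)
  where
  pascal : ∀ i → a i * (suc i C suc k) ≡ a i * (i C suc k) + a i * (i C k)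
  pascal i = trans (cong (a i *_) (trans (sym (nCk+nC[k+1]≡[n+1]C[k+1] i k)) (+-comm (i C k) (i C suc k))))
                   (*-distribˡ-+ (a i) (i C suc k) (i C k))

taylorShift-rec : ∀ N a b c k → (∀ i → a i ≡ b i + shift c i) →
  taylorShift (suc N) a k ≡ taylorShift (suc N) b k + (taylorShift N c k + shift (taylorShift N c) k)
taylorShift-rec N a b c k a≡b+shift-c = begin
  taylorShift (suc N) a k                                  ≡⟨ ∑-cong (suc N) (λ i _ → cong (_* (i C k)) (a≡b+shift-c i)) ⟩
  taylorShift (suc N) (λ i → b i + shift c i) k            ≡⟨ taylorShift-+ (suc N) b (shift c) k ⟩
  taylorShift (suc N) b k + taylorShift (suc N) (shift c) k ≡⟨ cong (_+_ (taylorShift (suc N) b k)) (taylorShift-shift N c k) ⟩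
  taylorShift (suc N) b k + (taylorShift N c k + shift (taylorShift N c) k) ∎
  where open ≡-Reasoning

taylorShift-deriv : ∀ N a k → suc k * taylorShift (suc N) a (suc k) ≡ taylorShift N (λ i → suc i * a (suc i)) k
taylorShift-deriv N a k = begin
  suc k * taylorShift (suc N) a (suc k)                   ≡⟨ cong (λ x → suc k * (x + tail)) (*-zeroʳ (a 0)) ⟩
  suc k * tail                                            ≡⟨ *-distribˡ-∑ N (suc k) _ ⟩
  ∑[ i < N ] (suc k * (a (suc i) * (suc i C suc k)))      ≡⟨ ∑-cong N (λ i _ → absorb i) ⟩
  taylorShift N (λ i → suc i * a (suc i)) k               ∎
  where
  open ≡-Reasoning
  tail : ℕ
  tail = ∑[ i < N ] (a (suc i) * (suc i C suc k))
  absorb : ∀ i → suc k * (a (suc i) * (suc i C suc k)) ≡ suc i * a (suc i) * (i C k)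
  absorb i = begin
    suc k * (a (suc i) * (suc i C suc k))   ≡⟨ x*[y*z]≡y*[x*z] (suc k) (a (suc i)) _ ⟩
    a (suc i) * (suc k * (suc i C suc k))   ≡⟨ cong (a (suc i) *_) ([k+1]*[n+1]C[k+1]≡[n+1]*nCk i k) ⟩
    a (suc i) * (suc i * (i C k))           ≡⟨ x*[y*z]≡y*[x*z] (a (suc i)) (suc i) _ ⟩
    suc i * (a (suc i) * (i C k))           ≡⟨ *-assoc (suc i) (a (suc i)) (i C k) ⟨
    suc i * a (suc i) * (i C k)             ∎
    where
    x*[y*z]≡y*[x*z] : ∀ x y z → x * (y * z) ≡ y * (x * z)
    x*[y*z]≡y*[x*z] = solve-∀

taylorShift-trailing-zeros : ∀ {N M} a k → N ≤ M → (∀ i → N ≤ i → a i ≡ 0) →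
  taylorShift M a k ≡ taylorShift N a k
taylorShift-trailing-zeros a k N≤M a≡0 =
  ∑-trailing-zeros (λ i → a i * (i C k)) N≤M (λ i N≤i → cong (_* (i C k)) (a≡0 i N≤i))

-- Fibonacci and Lucas polynomials

fibCoeff : ℕ → ℕ → ℕ
fibCoeff m i = (m ∸ i) C i

fibCoeff-vanish : ∀ m i → m < i + i → fibCoeff m i ≡ 0
fibCoeff-vanish m (suc i) m<2i = k>n⇒nCk≡0 (m<n+o⇒m∸n<o m (suc i) m<2i)

fibCoeff-rec : ∀ m i → fibCoeff (2 + m) i ≡ fibCoeff (1 + m) i + shift (fibCoeff m) i
fibCoeff-rec m zero = refl
fibCoeff-rec m (suc j) with j ≤? m
... | yes j≤m rewrite +-∸-assoc 1 j≤m =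
  trans (sym (nCk+nC[k+1]≡[n+1]C[k+1] (m ∸ j) j)) (+-comm ((m ∸ j) C j) _)
... | no j≰m with ≰⇒> j≰m
... | s≤s {n = j′} m≤j′ rewrite m≤n⇒m∸n≡0 m≤j′ | m≤n⇒m∸n≡0 (m≤n⇒m≤1+n m≤j′) = refl

fib : ℕ → ℕ → ℕ
fib m k = taylorShift (suc m) (fibCoeff m) k

fib-extend : ∀ {N} m k → suc m ≤ N → taylorShift N (fibCoeff m) k ≡ fib m k
fib-extend m k m<N = taylorShift-trailing-zeros (fibCoeff m) k m<N
  (λ i m<i → fibCoeff-vanish m i (<-≤-trans m<i (m≤m+n i i)))

fib-rec : ∀ m k → fib (2 + m) k ≡ fib (1 + m) k + (fib m k + shift (fib m) k)
fib-rec m k = begin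
  fib (2 + m) k
    ≡⟨ taylorShift-rec (2 + m) (fibCoeff (2 + m)) (fibCoeff (1 + m)) (fibCoeff m) k (fibCoeff-rec m) ⟩
  taylorShift (3 + m) (fibCoeff (1 + m)) k + (taylorShift (2 + m) (fibCoeff m) k + shift (taylorShift (2 + m) (fibCoeff m)) k)
    ≡⟨ cong₂ _+_ (fib-extend (1 + m) k (n≤1+n _))
                 (cong₂ _+_ (fib-extend m k (n≤1+n _)) (shift-cong (λ j → fib-extend m j (n≤1+n _)) k)) ⟩
  fib (1 + m) k + (fib m k + shift (fib m) k)
    ∎
  where open ≡-Reasoning

-- For 2 ≤ n and i < n this is the paper's n/(n-i) · C(n-i,i) (lucasCoeff-frac).
lucasCoeff : ℕ → ℕ → ℕ
lucasCoeff n i = fibCoeff n i + shift (fibCoeff (n ∸ 2)) i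

lucas : ℕ → ℕ → ℕ
lucas n k = taylorShift (suc n) (lucasCoeff n) k

lucasCoeff-frac : ∀ p i → i < 2 + p → (2 + p ∸ i) * lucasCoeff (2 + p) i ≡ (2 + p) * fibCoeff (2 + p) i
lucasCoeff-frac p zero    _           = refl
lucasCoeff-frac p (suc j) (s≤s j<1+p) with m≤n⇒∃[o]m+o≡n (s≤s⁻¹ j<1+p)
... | a , refl rewrite +-∸-assoc 1 (m≤m+n j a) | m+n∸m≡n j a = begin
  suc a * (suc a C suc j + a C j)                     ≡⟨ *-distribˡ-+ (suc a) (suc a C suc j) (a C j) ⟩
  suc a * (suc a C suc j) + suc a * (a C j)           ≡⟨ cong (_+_ (suc a * (suc a C suc j))) ([k+1]*[n+1]C[k+1]≡[n+1]*nCk a j) ⟨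
  suc a * (suc a C suc j) + suc j * (suc a C suc j)   ≡⟨ *-distribʳ-+ (suc a C suc j) (suc a) (suc j) ⟨
  (suc a + suc j) * (suc a C suc j)                   ≡⟨ cong (_* (suc a C suc j)) (sum a j) ⟩
  (2 + (j + a)) * (suc a C suc j)                     ∎
  where
  open ≡-Reasoning
  sum : ∀ a j → suc a + suc j ≡ 2 + (j + a)
  sum = solve-∀

lucasCoeff-vanish : ∀ p i → 2 + p < i + i → lucasCoeff (2 + p) i ≡ 0
lucasCoeff-vanish p (suc i) n<2i = cong₂ _+_ (fibCoeff-vanish (2 + p) (suc i) n<2i)
  (fibCoeff-vanish p i (s≤s⁻¹ (s≤s⁻¹ (subst (2 + p <_) (cong suc (+-suc i i)) n<2i))))

lucasCoeff-vanish-≥ : ∀ p i → 2 + p ≤ i → lucasCoeff (2 + p) i ≡ 0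
lucasCoeff-vanish-≥ p i n≤i = lucasCoeff-vanish p i (≤-<-trans n≤i (m<m+n i (<-≤-trans z<s n≤i)))

lucas-extend : ∀ {N} p k → 2 + p ≤ N → taylorShift N (lucasCoeff (2 + p)) k ≡ lucas (2 + p) k
lucas-extend p k n≤N =
  trans (taylorShift-trailing-zeros (lucasCoeff (2 + p)) k n≤N (lucasCoeff-vanish-≥ p))
        (sym (taylorShift-trailing-zeros (lucasCoeff (2 + p)) k (n≤1+n _) (lucasCoeff-vanish-≥ p)))

lucas-fib : ∀ p k → lucas (2 + p) k ≡ fib (2 + p) k + (fib p k + shift (fib p) k)
lucas-fib p k = begin
  lucas (2 + p) k
    ≡⟨ taylorShift-rec (2 + p) (lucasCoeff (2 + p)) (fibCoeff (2 + p)) (fibCoeff p) k (λ i → refl) ⟩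
  fib (2 + p) k + (taylorShift (2 + p) (fibCoeff p) k + shift (taylorShift (2 + p) (fibCoeff p)) k)
    ≡⟨ cong (_+_ (fib (2 + p) k)) (cong₂ _+_ (fib-extend p k (n≤1+n _)) (shift-cong (λ j → fib-extend p j (n≤1+n _)) k)) ⟩
  fib (2 + p) k + (fib p k + shift (fib p) k)
    ∎
  where open ≡-Reasoning

lucas-fib′ : ∀ p k → lucas (2 + p) k ≡ fib (1 + p) k + 2 * (fib p k + shift (fib p) k)
lucas-fib′ p k = begin
  lucas (2 + p) k                       ≡⟨ lucas-fib p k ⟩
  fib (2 + p) k + yv                    ≡⟨ cong (_+ yv) (fib-rec p k) ⟩
  fib (1 + p) k + yv + yv               ≡⟨ double (fib (1 + p) k) yv ⟩
  fib (1 + p) k + 2 * yv                ∎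
  where
  open ≡-Reasoning
  yv : ℕ
  yv = fib p k + shift (fib p) k
  double : ∀ u w → u + w + w ≡ u + 2 * w
  double = solve-∀

lucasCoeff-rec : ∀ p i → lucasCoeff (4 + p) i ≡ lucasCoeff (3 + p) i + shift (lucasCoeff (2 + p)) i
lucasCoeff-rec p zero    = refl
lucasCoeff-rec p (suc j) = begin
  fibCoeff (4 + p) (suc j) + fibCoeff (2 + p) j
    ≡⟨ cong (_+ fibCoeff (2 + p) j) (fibCoeff-rec (2 + p) (suc j)) ⟩
  fibCoeff (3 + p) (suc j) + fibCoeff (2 + p) j + fibCoeff (2 + p) j
    ≡⟨ cong (λ x → fibCoeff (3 + p) (suc j) + x + fibCoeff (2 + p) j) (fibCoeff-rec p j) ⟩
  fibCoeff (3 + p) (suc j) + (fibCoeff (1 + p) j + shift (fibCoeff p) j) + fibCoeff (2 + p) j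
    ≡⟨ regroup (fibCoeff (3 + p) (suc j)) (fibCoeff (1 + p) j) (shift (fibCoeff p) j) (fibCoeff (2 + p) j) ⟩
  fibCoeff (3 + p) (suc j) + fibCoeff (1 + p) j + (fibCoeff (2 + p) j + shift (fibCoeff p) j)
    ∎
  where
  open ≡-Reasoning
  regroup : ∀ a b c d → a + (b + c) + d ≡ a + b + (d + c)
  regroup = solve-∀

lucas-rec : ∀ p k → lucas (4 + p) k ≡ lucas (3 + p) k + (lucas (2 + p) k + shift (lucas (2 + p)) k)
lucas-rec p k = begin
  lucas (4 + p) k
    ≡⟨ taylorShift-rec (4 + p) (lucasCoeff (4 + p)) (lucasCoeff (3 + p)) (lucasCoeff (2 + p)) k (lucasCoeff-rec p) ⟩
  taylorShift (5 + p) (lucasCoeff (3 + p)) k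
    + (taylorShift (4 + p) (lucasCoeff (2 + p)) k + shift (taylorShift (4 + p) (lucasCoeff (2 + p))) k)
    ≡⟨ cong₂ _+_ (lucas-extend (1 + p) k (m≤n+m (3 + p) 2))
                 (cong₂ _+_ (lucas-extend p k 2+p≤4+p) (shift-cong (λ j → lucas-extend p j 2+p≤4+p) k)) ⟩
  lucas (3 + p) k + (lucas (2 + p) k + shift (lucas (2 + p)) k)
    ∎
  where
  open ≡-Reasoning
  2+p≤4+p : 2 + p ≤ 4 + p
  2+p≤4+p = m≤n+m (2 + p) 2

lucasCoeff-deriv : ∀ p i → i ≤ p → suc i * lucasCoeff (2 + p) (suc i) ≡ (2 + p) * fibCoeff p i
lucasCoeff-deriv p i i≤p with m≤n⇒∃[o]m+o≡n i≤p
... | a , refl rewrite +-∸-assoc 1 (m≤m+n i a) | m+n∸m≡n i a = begin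
  suc i * (suc a C suc i + a C i)                ≡⟨ *-distribˡ-+ (suc i) (suc a C suc i) (a C i) ⟩
  suc i * (suc a C suc i) + suc i * (a C i)      ≡⟨ cong (_+ suc i * (a C i)) ([k+1]*[n+1]C[k+1]≡[n+1]*nCk a i) ⟩
  suc a * (a C i) + suc i * (a C i)              ≡⟨ *-distribʳ-+ (a C i) (suc a) (suc i) ⟨
  (suc a + suc i) * (a C i)                      ≡⟨ cong (_* (a C i)) (sum a i) ⟩
  (2 + (i + a)) * (a C i)                        ∎
  where
  open ≡-Reasoning
  sum : ∀ a i → suc a + suc i ≡ 2 + (i + a)
  sum = solve-∀

lucas-deriv : ∀ p k → k * lucas (2 + p) k ≡ (2 + p) * shift (fib p) k
lucas-deriv p zero    = sym (*-zeroʳ (2 + p))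
lucas-deriv p (suc k) = begin
  suc k * lucas (2 + p) (suc k)
    ≡⟨ cong (suc k *_) (lucas-extend p (suc k) ≤-refl) ⟨
  suc k * taylorShift (2 + p) (lucasCoeff (2 + p)) (suc k)
    ≡⟨ taylorShift-deriv (1 + p) (lucasCoeff (2 + p)) k ⟩
  taylorShift (1 + p) (λ i → suc i * lucasCoeff (2 + p) (suc i)) k
    ≡⟨ ∑-cong (1 + p) (λ i i<1+p → cong (_* (i C k)) (lucasCoeff-deriv p i (s≤s⁻¹ i<1+p))) ⟩
  taylorShift (1 + p) (λ i → (2 + p) * fibCoeff p i) k
    ≡⟨ taylorShift-* (1 + p) (2 + p) (fibCoeff p) k ⟩
  (2 + p) * fib p k
    ∎
  where open ≡-Reasoning

-- From ℕ to ℚ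

toℚ : ℕ → ℚ
toℚ n = frac (+ n) 1

toℚᵘ-frac : ∀ a d .{{_ : NonZero d}} → toℚᵘ (frac a d) ≃ mkℚᵘ a (pred d)
toℚᵘ-frac a (suc b) = toℚᵘ-fromℚᵘ (mkℚᵘ a b)

toℚ-+ : ∀ m n → toℚ (m + n) ≡ toℚ m +ℚ toℚ n
toℚ-+ m n = toℚᵘ-injective (let open ℚᵘ.≃-Reasoning in begin
  toℚᵘ (toℚ (m + n))                  ≈⟨ toℚᵘ-frac (+ (m + n)) 1 ⟩
  mkℚᵘ (+ (m + n)) 0                  ≈⟨ *≡* (cong (ℤ._* + 1) cross) ⟩
  mkℚᵘ (+ m) 0 ℚᵘ.+ mkℚᵘ (+ n) 0      ≈⟨ ℚᵘ.+-cong (toℚᵘ-frac (+ m) 1) (toℚᵘ-frac (+ n) 1) ⟨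
  toℚᵘ (toℚ m) ℚᵘ.+ toℚᵘ (toℚ n)      ≈⟨ toℚᵘ-homo-+ (toℚ m) (toℚ n) ⟨
  toℚᵘ (toℚ m +ℚ toℚ n)               ∎)
  where
  cross : + (m + n) ≡ + m ℤ.* + 1 ℤ.+ + n ℤ.* + 1
  cross = trans (ℤ.pos-+ m n) (sym (cong₂ ℤ._+_ (ℤ.*-identityʳ (+ m)) (ℤ.*-identityʳ (+ n))))

toℚ-∑ : ∀ L (f : ℕ → ℚ) (g : ℕ → ℕ) → (∀ i → f i ≡ toℚ (g i)) → sumℚ (applyUpTo f L) ≡ toℚ (∑ L g)
toℚ-∑ zero    f g f≗g = refl
toℚ-∑ (suc L) f g f≗g =
  trans (cong₂ _+ℚ_ (f≗g 0) (toℚ-∑ L (f ∘ suc) (g ∘ suc) (f≗g ∘ suc))) (sym (toℚ-+ (g 0) (∑ L (g ∘ suc))))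

frac-*-toℚ : ∀ a d c e .{{_ : NonZero d}} → a * c ≡ d * e → frac (+ a) d *ℚ toℚ c ≡ toℚ e
frac-*-toℚ a d@(suc b) c e ac≡de = toℚᵘ-injective (let open ℚᵘ.≃-Reasoning in begin
  toℚᵘ (frac (+ a) d *ℚ toℚ c)                  ≈⟨ toℚᵘ-homo-* (frac (+ a) d) (toℚ c) ⟩
  toℚᵘ (frac (+ a) d) ℚᵘ.* toℚᵘ (toℚ c)         ≈⟨ ℚᵘ.*-cong (toℚᵘ-frac (+ a) d) (toℚᵘ-frac (+ c) 1) ⟩
  mkℚᵘ (+ a) b ℚᵘ.* mkℚᵘ (+ c) 0                ≈⟨ *≡* cross ⟩
  mkℚᵘ (+ e) 0                                  ≈⟨ toℚᵘ-frac (+ e) 1 ⟨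
  toℚᵘ (toℚ e)                                  ∎)
  where
  cross : (+ a ℤ.* + c) ℤ.* + 1 ≡ + e ℤ.* + suc (b * 1)
  cross rewrite *-identityʳ b = begin
    (+ a ℤ.* + c) ℤ.* + 1   ≡⟨ ℤ.*-identityʳ (+ a ℤ.* + c) ⟩
    + a ℤ.* + c             ≡⟨ ℤ.pos-* a c ⟨
    + (a * c)               ≡⟨ cong +_ ac≡de ⟩
    + (d * e)               ≡⟨ cong +_ (*-comm d e) ⟩
    + (e * d)               ≡⟨ ℤ.pos-* e d ⟩
    + e ℤ.* + d             ∎
    where open ≡-Reasoning

neg-frac : ∀ a d .{{_ : NonZero d}} → -ℚ frac a d ≡ frac (ℤ.- a) d
neg-frac a d = toℚᵘ-injective (let open ℚᵘ.≃-Reasoning in begin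
  toℚᵘ (-ℚ frac a d)      ≈⟨ toℚᵘ-homo‿- (frac a d) ⟩
  ℚᵘ.- toℚᵘ (frac a d)    ≈⟨ ℚᵘ.-‿cong (toℚᵘ-frac a d) ⟩
  mkℚᵘ (ℤ.- a) (pred d)   ≈⟨ toℚᵘ-frac (ℤ.- a) d ⟨
  toℚᵘ (frac (ℤ.- a) d)   ∎)

frac-combination : ∀ (x y z a c : ℤ) E D .{{_ : NonZero E}} .{{_ : NonZero D}} →
  x ℤ.* (+ E ℤ.* + D) ≡ a ℤ.* y ℤ.* + D ℤ.+ c ℤ.* z ℤ.* + E →
  frac x 1 ≡ frac a E *ℚ frac y 1 +ℚ frac c D *ℚ frac z 1
frac-combination x y z a c E@(suc e) D@(suc d) cross = toℚᵘ-injective (let open ℚᵘ.≃-Reasoning in begin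
  toℚᵘ (frac x 1)                                    ≈⟨ toℚᵘ-frac x 1 ⟩
  mkℚᵘ x 0                                           ≈⟨ *≡* cross′ ⟩
  mkℚᵘ a e ℚᵘ.* mkℚᵘ y 0 ℚᵘ.+ mkℚᵘ c d ℚᵘ.* mkℚᵘ z 0
    ≈⟨ ℚᵘ.+-cong (ℚᵘ.*-cong (toℚᵘ-frac a E) (toℚᵘ-frac y 1)) (ℚᵘ.*-cong (toℚᵘ-frac c D) (toℚᵘ-frac z 1)) ⟨
  toℚᵘ (frac a E) ℚᵘ.* toℚᵘ (frac y 1) ℚᵘ.+ toℚᵘ (frac c D) ℚᵘ.* toℚᵘ (frac z 1)
    ≈⟨ ℚᵘ.+-cong (toℚᵘ-homo-* (frac a E) (frac y 1)) (toℚᵘ-homo-* (frac c D) (frac z 1)) ⟨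
  toℚᵘ (frac a E *ℚ frac y 1) ℚᵘ.+ toℚᵘ (frac c D *ℚ frac z 1)
    ≈⟨ toℚᵘ-homo-+ (frac a E *ℚ frac y 1) (frac c D *ℚ frac z 1) ⟨
  toℚᵘ (frac a E *ℚ frac y 1 +ℚ frac c D *ℚ frac z 1) ∎)
  where
  cross′ : x ℤ.* + (suc (e * 1) * suc (d * 1)) ≡ (a ℤ.* y ℤ.* + suc (d * 1) ℤ.+ c ℤ.* z ℤ.* + suc (e * 1)) ℤ.* + 1
  cross′ rewrite *-identityʳ e | *-identityʳ d =
    trans (cong (x ℤ.*_) (ℤ.pos-* E D)) (trans cross (sym (ℤ.*-identityʳ _)))

pos-*³ : ∀ p q r → + (p * q * r) ≡ + p ℤ.* + q ℤ.* + r
pos-*³ p q r = trans (ℤ.pos-* (p * q) r) (cong (ℤ._* + r) (ℤ.pos-* p q))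

toℚ-combination⁺ : ∀ X Y Z a c e d .{{_ : NonZero e}} .{{_ : NonZero d}} →
  e * d * X ≡ a * Y + e * c * Z → toℚ X ≡ frac (+ a) (e * d) *ℚ toℚ Y +ℚ frac (+ c) d *ℚ toℚ Z
toℚ-combination⁺ X Y Z a c e@(suc _) d@(suc _) cleared = frac-combination (+ X) (+ Y) (+ Z) (+ a) (+ c) (e * d) d (begin
  + X ℤ.* (+ (e * d) ℤ.* + d)                        ≡⟨ cong (ℤ._*_ (+ X)) (ℤ.pos-* (e * d) d) ⟨
  + X ℤ.* + (e * d * d)                              ≡⟨ ℤ.pos-* X (e * d * d) ⟨
  + (X * (e * d * d))                                ≡⟨ cong +_ scaled ⟩
  + (a * Y * d + c * Z * (e * d))                    ≡⟨ ℤ.pos-+ (a * Y * d) (c * Z * (e * d)) ⟩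
  + (a * Y * d) ℤ.+ + (c * Z * (e * d))              ≡⟨ cong₂ ℤ._+_ (pos-*³ a Y d) (pos-*³ c Z (e * d)) ⟩
  + a ℤ.* + Y ℤ.* + d ℤ.+ + c ℤ.* + Z ℤ.* + (e * d)  ∎)
  where
  open ≡-Reasoning
  scaled : X * (e * d * d) ≡ a * Y * d + c * Z * (e * d)
  scaled = begin
    X * (e * d * d)              ≡⟨ reassoc X e d ⟩
    e * d * X * d                ≡⟨ cong (_* d) cleared ⟩
    (a * Y + e * c * Z) * d      ≡⟨ expand a Y e c Z d ⟩
    a * Y * d + c * Z * (e * d)  ∎
    where
    reassoc : ∀ X e d → X * (e * d * d) ≡ e * d * X * d
    reassoc = solve-∀
    expand : ∀ a Y e c Z d → (a * Y + e * c * Z) * d ≡ a * Y * d + c * Z * (e * d)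
    expand = solve-∀

toℚ-combination⁻ : ∀ X Y Z a c e d .{{_ : NonZero e}} .{{_ : NonZero d}} →
  e * d * X + a * Y ≡ e * c * Z → toℚ X ≡ (-ℚ frac (+ a) (e * d)) *ℚ toℚ Y +ℚ frac (+ c) d *ℚ toℚ Z
toℚ-combination⁻ X Y Z a c e@(suc _) d@(suc _) cleared = begin
  toℚ X
    ≡⟨ frac-combination (+ X) (+ Y) (+ Z) (ℤ.- + a) (+ c) (e * d) d cross ⟩
  frac (ℤ.- + a) (e * d) *ℚ toℚ Y +ℚ frac (+ c) d *ℚ toℚ Z
    ≡⟨ cong (λ q → q *ℚ toℚ Y +ℚ frac (+ c) d *ℚ toℚ Z) (neg-frac (+ a) (e * d)) ⟨
  (-ℚ frac (+ a) (e * d)) *ℚ toℚ Y +ℚ frac (+ c) d *ℚ toℚ Z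
    ∎
  where
  open ≡-Reasoning
  scaled : X * (e * d * d) + a * Y * d ≡ c * Z * (e * d)
  scaled = begin
    X * (e * d * d) + a * Y * d    ≡⟨ factor X e d a Y ⟩
    (e * d * X + a * Y) * d        ≡⟨ cong (_* d) cleared ⟩
    e * c * Z * d                  ≡⟨ reassoc e c Z d ⟩
    c * Z * (e * d)                ∎
    where
    factor : ∀ X e d a Y → X * (e * d * d) + a * Y * d ≡ (e * d * X + a * Y) * d
    factor = solve-∀
    reassoc : ∀ e c Z d → e * c * Z * d ≡ c * Z * (e * d)
    reassoc = solve-∀
  cast : + X ℤ.* (+ (e * d) ℤ.* + d) ℤ.+ + a ℤ.* + Y ℤ.* + d ≡ + c ℤ.* + Z ℤ.* + (e * d)
  cast = begin
    + X ℤ.* (+ (e * d) ℤ.* + d) ℤ.+ + a ℤ.* + Y ℤ.* + d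
      ≡⟨ cong₂ ℤ._+_ (trans (ℤ.pos-* X (e * d * d)) (cong (ℤ._*_ (+ X)) (ℤ.pos-* (e * d) d))) (pos-*³ a Y d) ⟨
    + (X * (e * d * d)) ℤ.+ + (a * Y * d)    ≡⟨ ℤ.pos-+ (X * (e * d * d)) (a * Y * d) ⟨
    + (X * (e * d * d) + a * Y * d)          ≡⟨ cong +_ scaled ⟩
    + (c * Z * (e * d))                      ≡⟨ pos-*³ c Z (e * d) ⟩
    + c ℤ.* + Z ℤ.* + (e * d)                ∎
  cross : + X ℤ.* (+ (e * d) ℤ.* + d) ≡ (ℤ.- + a) ℤ.* + Y ℤ.* + d ℤ.+ + c ℤ.* + Z ℤ.* + (e * d)
  cross = trans (isolate (+ X ℤ.* (+ (e * d) ℤ.* + d)) (+ a) (+ Y) (+ d)) (cong (ℤ._+_ ((ℤ.- + a) ℤ.* + Y ℤ.* + d)) cast)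
    where
    isolate : ∀ u a y d → u ≡ (ℤ.- a) ℤ.* y ℤ.* d ℤ.+ (u ℤ.+ a ℤ.* y ℤ.* d)
    isolate = ℤ-solve-∀

n/2<i⇒n<i+i : ∀ {n i} → n / 2 < i → n < i + i
n/2<i⇒n<i+i {n} {i} n/2<i = ≰⇒> λ i+i≤n → <⇒≱ n/2<i (begin
  i             ≡⟨ m*n/n≡m i 2 ⟨
  i * 2 / 2     ≤⟨ /-monoˡ-≤ 2 (subst (_≤ n) (i+i≡i*2 i) i+i≤n) ⟩
  n / 2         ∎)
  where
  open ≤-Reasoning
  i+i≡i*2 : ∀ i → i + i ≡ i * 2
  i+i≡i*2 = solve-∀

JL-term : ∀ p k i → frac (+ (2 + p)) (2 + p ∸ i) *ℚ toℚ (fibCoeff (2 + p) i * (i C k))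
                    ≡ toℚ (lucasCoeff (2 + p) i * (i C k))
JL-term p k i with i <? 2 + p
... | yes i<n = frac-*-toℚ (2 + p) (2 + p ∸ i) (fibCoeff (2 + p) i * (i C k)) (lucasCoeff (2 + p) i * (i C k))
                          {{>-nonZero (m<n⇒0<n∸m i<n)}} (begin
  (2 + p) * (fibCoeff (2 + p) i * (i C k))            ≡⟨ *-assoc (2 + p) (fibCoeff (2 + p) i) (i C k) ⟨
  (2 + p) * fibCoeff (2 + p) i * (i C k)              ≡⟨ cong (_* (i C k)) (lucasCoeff-frac p i i<n) ⟨
  (2 + p ∸ i) * lucasCoeff (2 + p) i * (i C k)        ≡⟨ *-assoc (2 + p ∸ i) (lucasCoeff (2 + p) i) (i C k) ⟩
  (2 + p ∸ i) * (lucasCoeff (2 + p) i * (i C k))      ∎)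
  where open ≡-Reasoning
-- For i ≥ n both sides vanish: frac _ 0 is 0ℚ, and so is lucasCoeff (2 + p) i.
... | no i≮n = begin
  frac (+ (2 + p)) (2 + p ∸ i) *ℚ toℚ c
    ≡⟨ cong (λ d → frac (+ (2 + p)) d *ℚ toℚ c) (m≤n⇒m∸n≡0 (≮⇒≥ i≮n)) ⟩
  0ℚ *ℚ toℚ c
    ≡⟨ ℚ.*-zeroˡ (toℚ c) ⟩
  0ℚ
    ≡⟨ cong (λ x → toℚ (x * (i C k))) (lucasCoeff-vanish-≥ p i (≮⇒≥ i≮n)) ⟨
  toℚ (lucasCoeff (2 + p) i * (i C k))
    ∎
  where
  open ≡-Reasoning
  c : ℕ
  c = fibCoeff (2 + p) i * (i C k)

JL≡toℚ-lucas : ∀ p k → JL (2 + p) k ≡ toℚ (lucas (2 + p) k)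
JL≡toℚ-lucas p k = begin
  sumℚ (map term (map (_+_ k) (upTo L)))
    ≡⟨ cong sumℚ (trans (cong (map term) (map-upTo (_+_ k) L)) (map-applyUpTo (_+_ k) term L)) ⟩
  sumℚ (applyUpTo (term ∘ (_+_ k)) L)
    ≡⟨ toℚ-∑ L (term ∘ (_+_ k)) (g ∘ (_+_ k)) (λ i → JL-term p k (k + i)) ⟩
  toℚ (∑[ i < L ] g (k + i))
    ≡⟨ cong toℚ (∑-leading-zeros (suc M) k g below-k) ⟨
  toℚ (taylorShift (suc M) (lucasCoeff n) k)
    ≡⟨ cong toℚ (taylorShift-trailing-zeros (lucasCoeff n) k (s≤s (m/n≤m n 2)) above-M) ⟨
  toℚ (lucas n k)
    ∎
  where
  open ≡-Reasoning
  n M L : ℕ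
  n = 2 + p
  M = n / 2
  L = suc M ∸ k
  term : ℕ → ℚ
  term i = frac (+ n) (n ∸ i) *ℚ toℚ (fibCoeff n i * (i C k))
  g : ℕ → ℕ
  g i = lucasCoeff n i * (i C k)
  above-M : ∀ i → suc M ≤ i → lucasCoeff n i ≡ 0
  above-M i M<i = lucasCoeff-vanish p i (n/2<i⇒n<i+i M<i)
  below-k : ∀ i → i < k → g i ≡ 0
  below-k i i<k = trans (cong (_*_ (lucasCoeff n i)) (k>n⇒nCk≡0 i<k)) (*-zeroʳ (lucasCoeff n i))

-- The three identities

-- Both sides plus 2(n+1)·j·A₋ equal (n+1)·n·A₋; adding rather than subtracting keeps this in ℕ.
identity₁-cleared : ∀ {n m j A₋ A B u v v′} → n ≡ m + 2 * suc j →
  A₋ ≡ u + 2 * (v + v′) → j * A₋ ≡ n * v′ → suc j * A ≡ n * v → suc j * B ≡ suc n * u →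
  (n + 1) * (m + 2) * A₋ ≡ suc j * n * B + (n + 1) * (2 * suc j) * A
identity₁-cleared {n} {m} {j} {A₋} {A} {B} {u} {v} {v′} n≡ A₋≡ jA₋ [1+j]A [1+j]B =
  +-cancelʳ-≡ _ _ _ (trans lhs (sym rhs))
  where
  open ≡-Reasoning
  lhs : (n + 1) * (m + 2) * A₋ + 2 * (n + 1) * (j * A₋) ≡ (n + 1) * n * A₋
  lhs = begin
    (n + 1) * (m + 2) * A₋ + 2 * (n + 1) * (j * A₋)   ≡⟨ solve (n ∷ m ∷ j ∷ A₋ ∷ []) ⟩
    (n + 1) * (m + 2 * suc j) * A₋                    ≡⟨ cong (λ x → (n + 1) * x * A₋) n≡ ⟨
    (n + 1) * n * A₋                                  ∎
  rhs : suc j * n * B + (n + 1) * (2 * suc j) * A + 2 * (n + 1) * (j * A₋) ≡ (n + 1) * n * A₋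
  rhs = begin
    suc j * n * B + (n + 1) * (2 * suc j) * A + 2 * (n + 1) * (j * A₋)
      ≡⟨ solve (n ∷ j ∷ A ∷ B ∷ A₋ ∷ []) ⟩
    n * (suc j * B) + 2 * (n + 1) * (suc j * A) + 2 * (n + 1) * (j * A₋)
      ≡⟨ cong₂ _+_ (cong₂ (λ x y → n * x + 2 * (n + 1) * y) [1+j]B [1+j]A) (cong (2 * (n + 1) *_) jA₋) ⟩
    n * (suc n * u) + 2 * (n + 1) * (n * v) + 2 * (n + 1) * (n * v′)
      ≡⟨ solve (n ∷ u ∷ v ∷ v′ ∷ []) ⟩
    (n + 1) * n * (u + 2 * (v + v′))
      ≡⟨ cong ((n + 1) * n *_) A₋≡ ⟨
    (n + 1) * n * A₋
      ∎

-- As in identity₁-cleared, both sides plus 2n·kB + 5(n+1)·kA are brought to a common value.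
identity₂-cleared : ∀ {n m k A₊ A B w u u′ v v′} → n ≡ m + 2 * k →
  A ≡ u + 2 * (v + v′) → B ≡ w + 2 * (u + u′) → w ≡ u + (v + v′) →
  suc k * A₊ ≡ n * v → k * A ≡ n * v′ → k * B ≡ suc n * u′ →
  (n + 1) * (5 * suc k) * A₊ + n * (m + 1) * B ≡ (n + 1) * (3 * m + k) * A
identity₂-cleared {n} {m} {k} {A₊} {A} {B} {w} {u} {u′} {v} {v′} n≡ A≡ B≡ w≡ [1+k]A₊ kA kB =
  +-cancelʳ-≡ _ _ _ (trans lhs (sym rhs))
  where
  open ≡-Reasoning
  lhs : (n + 1) * (5 * suc k) * A₊ + n * (m + 1) * B + (2 * n * (k * B) + 5 * (n + 1) * (k * A))
        ≡ (n + 1) * n * (3 * u + 2 * u′ + 6 * v + 6 * v′)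
  lhs = begin
    (n + 1) * (5 * suc k) * A₊ + n * (m + 1) * B + (2 * n * (k * B) + 5 * (n + 1) * (k * A))
      ≡⟨ solve (n ∷ m ∷ k ∷ A₊ ∷ A ∷ B ∷ []) ⟩
    5 * (n + 1) * (suc k * A₊) + n * (m + 2 * k + 1) * B + 5 * (n + 1) * (k * A)
      ≡⟨ cong₂ _+_ (cong₂ (λ x y → 5 * (n + 1) * x + n * (y + 1) * B) [1+k]A₊ (sym n≡)) (cong (5 * (n + 1) *_) kA) ⟩
    5 * (n + 1) * (n * v) + n * (n + 1) * B + 5 * (n + 1) * (n * v′)
      ≡⟨ cong (λ x → 5 * (n + 1) * (n * v) + n * (n + 1) * x + 5 * (n + 1) * (n * v′))
              (trans B≡ (cong (_+ 2 * (u + u′)) w≡)) ⟩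
    5 * (n + 1) * (n * v) + n * (n + 1) * (u + (v + v′) + 2 * (u + u′)) + 5 * (n + 1) * (n * v′)
      ≡⟨ solve (n ∷ u ∷ u′ ∷ v ∷ v′ ∷ []) ⟩
    (n + 1) * n * (3 * u + 2 * u′ + 6 * v + 6 * v′)
      ∎
  rhs : (n + 1) * (3 * m + k) * A + (2 * n * (k * B) + 5 * (n + 1) * (k * A))
        ≡ (n + 1) * n * (3 * u + 2 * u′ + 6 * v + 6 * v′)
  rhs = begin
    (n + 1) * (3 * m + k) * A + (2 * n * (k * B) + 5 * (n + 1) * (k * A))
      ≡⟨ solve (n ∷ m ∷ k ∷ A ∷ B ∷ []) ⟩
    3 * (n + 1) * (m + 2 * k) * A + 2 * n * (k * B)
      ≡⟨ cong₂ (λ x y → 3 * (n + 1) * x * A + 2 * n * y) (sym n≡) kB ⟩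
    3 * (n + 1) * n * A + 2 * n * (suc n * u′)
      ≡⟨ cong (λ x → 3 * (n + 1) * n * x + 2 * n * (suc n * u′)) A≡ ⟩
    3 * (n + 1) * n * (u + 2 * (v + v′)) + 2 * n * (suc n * u′)
      ≡⟨ solve (n ∷ u ∷ u′ ∷ v ∷ v′ ∷ []) ⟩
    (n + 1) * n * (3 * u + 2 * u′ + 6 * v + 6 * v′)
      ∎

identity₃-cleared : ∀ {n m k A₋ A B C} → n ≡ m + 2 * k → C ≡ B + (A + A₋) →
  (n + 1) * (m + 2) * A₋ ≡ k * n * B + (n + 1) * (2 * k) * A →
  (n + 1) * (m + 2) * C ≡ (m + k + 1) * (n + 2) * B + (n + 1) * (n + 2) * A
identity₃-cleared {m = m} {k} {A₋} {A} {B} {C} refl C≡ identity₁ = begin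
  (m + 2 * k + 1) * (m + 2) * C
    ≡⟨ cong ((m + 2 * k + 1) * (m + 2) *_) C≡ ⟩
  (m + 2 * k + 1) * (m + 2) * (B + (A + A₋))
    ≡⟨ solve (m ∷ k ∷ A₋ ∷ A ∷ B ∷ []) ⟩
  (m + 2 * k + 1) * (m + 2) * (B + A) + (m + 2 * k + 1) * (m + 2) * A₋
    ≡⟨ cong (_+_ ((m + 2 * k + 1) * (m + 2) * (B + A))) identity₁ ⟩
  (m + 2 * k + 1) * (m + 2) * (B + A) + (k * (m + 2 * k) * B + (m + 2 * k + 1) * (2 * k) * A)
    ≡⟨ solve (m ∷ k ∷ A ∷ B ∷ []) ⟩
  (m + k + 1) * (m + 2 * k + 2) * B + (m + 2 * k + 1) * (m + 2 * k + 2) * A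
    ∎
  where open ≡-Reasoning

-- p and q are explicit because unification cannot recover them through _+ℚ_ and _*ℚ_.
combination-cong : ∀ p q {p′ q′ X Y Z x y z : ℚ} → X ≡ x → Y ≡ y → Z ≡ z → p ≡ p′ → q ≡ q′ →
  x ≡ p′ *ℚ y +ℚ q′ *ℚ z → X ≡ p *ℚ Y +ℚ q *ℚ Z
combination-cong p q refl refl refl refl refl x≡ = x≡

module LucasRelations (p j : ℕ) (2k≤n : 2 * suc j ≤ 2 + p) where
  n k m : ℕ
  n = 2 + p
  k = suc j
  m = n ∸ 2 * k
  instance
    m+2≢0 : NonZero (m + 2)
    m+2≢0 = >-nonZero (<-≤-trans z<s (m≤n+m 2 m))
  n≡m+2k : n ≡ m + 2 * k
  n≡m+2k = sym (m∸n+n≡m 2k≤n)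
  n∸k≡m+k : n ∸ k ≡ m + k
  n∸k≡m+k = trans (cong (_∸ k) (trans n≡m+2k (m+2k≡m+k+k m k))) (m+n∸n≡m (m + k) k)
    where
    m+2k≡m+k+k : ∀ m k → m + 2 * k ≡ m + k + k
    m+2k≡m+k+k = solve-∀
  3n-5k≡3m+k : + (3 * n) -ℤ + (5 * k) ≡ + (3 * m + k)
  3n-5k≡3m+k = begin
    + (3 * n) -ℤ + (5 * k)          ≡⟨ ℤ.m-n≡m⊖n (3 * n) (5 * k) ⟩
    3 * n ⊖ 5 * k                   ≡⟨ cong (_⊖ 5 * k) (trans (cong (3 *_) n≡m+2k) (3[m+2k]≡3m+k+5k m k)) ⟩
    3 * m + k + 5 * k ⊖ 5 * k       ≡⟨ ℤ.⊖-≥ (m≤n+m (5 * k) (3 * m + k)) ⟩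
    + (3 * m + k + 5 * k ∸ 5 * k)   ≡⟨ cong +_ (m+n∸n≡m (3 * m + k) (5 * k)) ⟩
    + (3 * m + k)                   ∎
    where
    open ≡-Reasoning
    3[m+2k]≡3m+k+5k : ∀ m k → 3 * (m + 2 * k) ≡ 3 * m + k + 5 * k
    3[m+2k]≡3m+k+5k = solve-∀
  5[n+1][k+1]≡[n+1][5[1+k]] : 5 * (n + 1) * (k + 1) ≡ (n + 1) * (5 * suc k)
  5[n+1][k+1]≡[n+1][5[1+k]] = reorder n k
    where
    reorder : ∀ n k → 5 * (n + 1) * (k + 1) ≡ (n + 1) * (5 * suc k)
    reorder = solve-∀
  A B C : ℕ → ℕ
  A = lucas n
  B = lucas (1 + n)
  C = lucas (2 + n)
  JL-A : ∀ i → JL n i ≡ toℚ (A i)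
  JL-A = JL≡toℚ-lucas p
  JL-A₊ : JL n (k + 1) ≡ toℚ (A (suc k))
  JL-A₊ = trans (cong (JL n) (+-comm k 1)) (JL-A (suc k))
  JL-B : JL (n + 1) k ≡ toℚ (B k)
  JL-B = trans (cong (λ x → JL x k) (+-comm n 1)) (JL≡toℚ-lucas (1 + p) k)
  JL-C : JL (n + 2) k ≡ toℚ (C k)
  JL-C = trans (cong (λ x → JL x k) (+-comm n 2)) (JL≡toℚ-lucas (2 + p) k)
  cleared₁ : (n + 1) * (m + 2) * A j ≡ k * n * B k + (n + 1) * (2 * k) * A k
  cleared₁ = identity₁-cleared {n} {m} {j} {A j} {A k} {B k} {fib (1 + p) j} {fib p j} {shift (fib p) j} n≡m+2k
               (lucas-fib′ p j) (lucas-deriv p j) (lucas-deriv p k) (lucas-deriv (1 + p) k)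
  cleared₂ : (n + 1) * (5 * suc k) * A (suc k) + n * (m + 1) * B k ≡ (n + 1) * (3 * m + k) * A k
  cleared₂ = identity₂-cleared {n} {m} {k} {A (suc k)} {A k} {B k} {fib (2 + p) k} {fib (1 + p) k} {shift (fib (1 + p)) k}
               {fib p k} {shift (fib p) k} n≡m+2k (lucas-fib′ p k) (lucas-fib′ (1 + p) k) (fib-rec p k)
               (lucas-deriv p (suc k)) (lucas-deriv p k) (lucas-deriv (1 + p) k)
  cleared₃ : (n + 1) * (m + 2) * C k ≡ (m + k + 1) * (n + 2) * B k + (n + 1) * (n + 2) * A k
  cleared₃ = identity₃-cleared {n} {m} {k} {A j} {A k} {B k} {C k} n≡m+2k (lucas-rec p k) cleared₁

lemma2p1 : (n k : ℕ) → 1 ≤ n → 1 ≤ k → 2 * k ≤ n →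
    (JL n (k ∸ 1) ≡ frac (+ (k * n)) ((n + 1) * (n ∸ 2 * k + 2)) *ℚ JL (n + 1) k
                    +ℚ frac (+ (2 * k)) (n ∸ 2 * k + 2) *ℚ JL n k)
    × (JL n (k + 1) ≡ (-ℚ frac (+ (n * (n ∸ 2 * k + 1))) (5 * (n + 1) * (k + 1))) *ℚ JL (n + 1) k
                    +ℚ frac (+ (3 * n) -ℤ + (5 * k)) (5 * (k + 1)) *ℚ JL n k)
    × (JL (n + 2) k ≡ frac (+ ((n ∸ k + 1) * (n + 2))) ((n + 1) * (n ∸ 2 * k + 2)) *ℚ JL (n + 1) k
                    +ℚ frac (+ (n + 2)) (n ∸ 2 * k + 2) *ℚ JL n k)
lemma2p1 n             zero    _ () _
lemma2p1 zero          (suc j) _ _  ()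
lemma2p1 (suc zero)    (suc j) _ _  (s≤s 2j+1≤0) = contradiction (n≤0⇒n≡0 2j+1≤0) (m+1+n≢0 j)
lemma2p1 (suc (suc p)) (suc j) _ _  2k≤n =
    combination-cong (frac (+ (k * n)) ((n + 1) * (m + 2))) (frac (+ (2 * k)) (m + 2))
      (JL-A j) JL-B (JL-A k) refl refl
      (toℚ-combination⁺ (A j) (B k) (A k) (k * n) (2 * k) (n + 1) (m + 2) cleared₁)
  , combination-cong (-ℚ frac (+ (n * (m + 1))) (5 * (n + 1) * (k + 1))) (frac (+ (3 * n) -ℤ + (5 * k)) (5 * (k + 1)))
      JL-A₊ JL-B (JL-A k)
      (cong (λ E → -ℚ frac (+ (n * (m + 1))) E) 5[n+1][k+1]≡[n+1][5[1+k]])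
      (cong₂ frac 3n-5k≡3m+k (cong (5 *_) (+-comm k 1)))
      (toℚ-combination⁻ (A (suc k)) (B k) (A k) (n * (m + 1)) (3 * m + k) (n + 1) (5 * suc k) cleared₂)
  , combination-cong (frac (+ ((n ∸ k + 1) * (n + 2))) ((n + 1) * (m + 2))) (frac (+ (n + 2)) (m + 2))
      JL-C JL-B (JL-A k) (cong (λ a → frac (+ ((a + 1) * (n + 2))) ((n + 1) * (m + 2))) n∸k≡m+k) refl
      (toℚ-combination⁺ (C k) (B k) (A k) ((m + k + 1) * (n + 2)) (n + 2) (n + 1) (m + 2) cleared₃)
  where open LucasRelations p j 2k≤n
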